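{- Let $f:[n]\to[n]$ be a Hessenberg function with bounce number $b(f)=3$. Let $\xi=(\xi_1,\xi_2,\xi_3)$ be a partition of $n$ (with $\xi_1\ge\xi_2\ge\xi_3\ge0$) and let $T$ be an $f$-tableau of shape $\xi$. (1) If $\xi_3\ge1$, then $\sigma^{\square}_{3\to1}(T)$ is an $f$-tableau of shape $(\xi_1+1,\xi_2,\xi_3-1)$; hence $\sigma^{\square}_{3\to1}$ is a map from the set of $f$-tableaux of shape $(\xi_1,\xi_2,\xi_3)$ to the set of $f$-tableaux of shape $(\xi_1+1,\xi_2,\xi_3-1)$, and it is injective. (2) If $\xi_3\ge2$, then $\sigma^{\square\square}_{3\to1}(T)$ is an $f$-tableau of shape $(\xi_1+2,\xi_2,\xi_3-2)$; hence $\sigma^{\square\square}_{3\to1}$ is a map from the set of $f$-tableaux of shape $(\xi_1,\xi_2,\xi_3)$ to the set of $f$-tableaux of shape $(\xi_1+2,\xi_2,\xi_3-2)$, and it is injective.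
   Context: A Hessenberg function is a non-decreasing $f:[n]\to[n]$ with $i\le f(i)$; $P(f)$ is the poset on $[n]$ with $i\prec_f j$ iff $f(i)<j$. The bounce number: set $x_1=f(1)$, $x_{l+1}=f(x_l+1)$ while $x_l<n$; $b(f)$ is the $k$ with $x_k=n$. For a partition $\lambda\vdash n$, an $f$-tableau of shape $\lambda$ is a filling of the Young diagram of $\lambda$ (English convention, rows top to bottom) with each of $1,\dots,n$ exactly once such that (i) each column is strictly increasing from top to bottom with respect to $\prec_f$, and (ii) whenever $i$ and $j$ are adjacent in a row with $j$ immediately to the right of $i$, we do not have $j\prec_f i$. For a tableau $T$ of shape $\xi$, $\sigma^{\square}_{3\to1}(T)$ (defined when $\xi_3\ge1$) is obtained by moving the rightmost entry of the third row of $T$ to the end of the first row; $\sigma^{\square\square}_{3\to1}(T)$ (defined when $\xi_3\ge2$) is obtained by moving the two rightmost entries of the third row, keeping their order, to the end of the first row. -}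

module Defs where

open import Data.Nat using (ℕ; zero; suc; _+_; _∸_; _≤_; _<_)
open import Data.Product using (_×_; _,_)
open import Data.List using (List; length; _++_; take; drop; zip; map; upTo)
open import Data.List.Relation.Unary.All using (All)
open import Data.List.Relation.Unary.Linked using (Linked)
open import Data.List.Relation.Binary.Permutation.Propositional using (_↭_)
open import Relation.Binary.PropositionalEquality using (_≡_)
open import Relation.Nullary using (¬_)

-- Entries of [n] = {1,…,n} are natural numbers; f : ℕ → ℕ is only
-- constrained on [n].
record IsHessenberg (n : ℕ) (f : ℕ → ℕ) : Set where
  field
    extensive : ∀ i → 1 ≤ i → i ≤ n → i ≤ f i
    bounded   : ∀ i → 1 ≤ i → i ≤ n → f i ≤ n
    monotone  : ∀ i j → 1 ≤ i → i ≤ j → j ≤ n → f i ≤ f j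

_≺[_]_ : ℕ → (ℕ → ℕ) → ℕ → Set
i ≺[ f ] j = f i < j

-- bounce sequence: bounceSeq f 1 = x₁ = f 1, x_{l+1} = f (x_l + 1)
-- (bounceSeq f 0 = 0 is a convenient base: then x₁ = f (0 + 1))
bounceSeq : (ℕ → ℕ) → ℕ → ℕ
bounceSeq f zero    = 0
bounceSeq f (suc l) = f (bounceSeq f l + 1)

-- b(f) = k : x_k = n, and x_l < n for 1 ≤ l < k (so the sequence was defined up to k)
BounceNumber : ℕ → (ℕ → ℕ) → ℕ → Set
BounceNumber n f k = bounceSeq f k ≡ n × (∀ l → 1 ≤ l → l < k → bounceSeq f l < n)

-- A filling of a (at most) three-row Young diagram: the three rows, top to bottom,
-- each listed left to right.
record Tableau3 : Set where
  constructor tab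
  field
    row₁ row₂ row₃ : List ℕ
open Tableau3 public

-- consecutive entries of each column strictly increase w.r.t. ≺_f
-- (zip pairs the j-th entries of two rows, for all columns of the lower row)
ColumnsOK : (ℕ → ℕ) → List ℕ → List ℕ → Set
ColumnsOK f upper lower = All (λ { (a , b) → a ≺[ f ] b }) (zip upper lower)

RowOK : (ℕ → ℕ) → List ℕ → Set
RowOK f = Linked (λ i j → ¬ (j ≺[ f ] i))

record IsFTableau (n : ℕ) (f : ℕ → ℕ) (ξ₁ ξ₂ ξ₃ : ℕ) (T : Tableau3) : Set where
  field
    shape₁ : length (row₁ T) ≡ ξ₁
    shape₂ : length (row₂ T) ≡ ξ₂
    shape₃ : length (row₃ T) ≡ ξ₃
    filling : (row₁ T ++ row₂ T ++ row₃ T) ↭ map suc (upTo n)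
    cols₁₂ : ColumnsOK f (row₁ T) (row₂ T)
    cols₂₃ : ColumnsOK f (row₂ T) (row₃ T)
    rowOK₁ : RowOK f (row₁ T)
    rowOK₂ : RowOK f (row₂ T)
    rowOK₃ : RowOK f (row₃ T)

σ□ : Tableau3 → Tableau3
σ□ (tab r₁ r₂ r₃) = tab (r₁ ++ drop (length r₃ ∸ 1) r₃) r₂ (take (length r₃ ∸ 1) r₃)

σ□□ : Tableau3 → Tableau3
σ□□ (tab r₁ r₂ r₃) = tab (r₁ ++ drop (length r₃ ∸ 2) r₃) r₂ (take (length r₃ ∸ 2) r₃)

module Submission where

-- An entry z of row 3 sits under a column
-- x ≺_f y ≺_f z of entries of [n].  Climbing the bounce sequence,
-- x ≥ 1 > x₀ forces f x ≥ x₁, so y > x₁ and f y ≥ x₂, so z > x₂ and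
-- f z ≥ x₃ = n: every entry of row 3 is "saturated".  A saturated entry is
-- never ≺_f-below an entry of [n], so any saturated entries may be appended
-- to row 1 without breaking the row condition.  Moving the last m entries of
-- row 3 to the end of row 1 (m = 1 gives σ^□, m = 2 gives σ^□□) therefore
-- preserves the row conditions; the column conditions survive because row 1
-- only grows to the right of row 2 and row 3 only shrinks; the filling is a
-- rearrangement.  Since row 1 of a tableau of shape ξ has length ξ₁, the
-- moved entries can be split off again, so the move is injective.

open import Defs
open import Data.Nat using (ℕ; zero; suc; _+_; _∸_; _≤_; _<_; _⊓_; s≤s; z≤n)
open import Data.Nat.Properties
  using (≤-trans; ≤-<-trans; +-comm; m≤n+m; m∸[m∸n]≡n; m≤n⇒m⊓n≡m; m∸n≤m; <⇒≱; suc-injective)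
open import Data.Product using (_×_; _,_)
open import Data.List using (List; []; _∷_; length; _++_; take; drop; zip; map; upTo)
open import Data.List.Properties
  using (length-++; length-take; length-drop; take++drop≡id; ++-assoc; zipWith-zeroʳ; ∷-injective)
open import Data.List.Relation.Unary.All as All using (All; []; _∷_)
import Data.List.Relation.Unary.All.Properties as All
open import Data.List.Relation.Unary.Linked using (Linked; []; [-]; _∷_)
open import Data.List.Relation.Binary.Permutation.Propositional
  using (_↭_; ↭-trans; ↭-reflexive; ↭-sym)
open import Data.List.Relation.Binary.Permutation.Propositional.Properties
  using (++⁺ˡ; ++-comm; All-resp-↭)
open import Relation.Binary.PropositionalEquality
  using (_≡_; refl; sym; trans; cong; cong₂; subst; subst₂; module ≡-Reasoning)
open import Relation.Nullary using (¬_)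

private
  variable
    A B : Set
    R : A → A → Set

linked-take : ∀ k {xs} → Linked R xs → Linked R (take k xs)
linked-take zero          _       = []
linked-take (suc k)       []      = []
linked-take (suc zero)    [-]     = [-]
linked-take (suc (suc k)) [-]     = [-]
linked-take (suc zero)    (_ ∷ _) = [-]
linked-take (suc (suc k)) (r ∷ l) = r ∷ linked-take (suc k) l

linked-drop : ∀ k {xs} → Linked R xs → Linked R (drop k xs)
linked-drop zero          l       = l
linked-drop (suc k)       []      = []
linked-drop (suc zero)    [-]     = []
linked-drop (suc (suc k)) [-]     = []
linked-drop (suc k)       (_ ∷ l) = linked-drop k l

linked-++ : ∀ {xs ys} → Linked R xs → Linked R ys →
  All (λ a → All (R a) ys) xs → Linked R (xs ++ ys)
linked-++ []                  lys _               = lys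
linked-++ {ys = []}     [-]   _   _               = [-]
linked-++ {ys = _ ∷ _}  [-]   lys ((r ∷ _) ∷ [])  = r ∷ lys
linked-++ (r ∷ lxs)           lys (_ ∷ rel)       = r ∷ linked-++ lxs lys rel

zip-++ˡ : (xs zs : List A) (ys : List B) → length ys ≤ length xs →
  zip (xs ++ zs) ys ≡ zip xs ys
zip-++ˡ xs       zs []       _ = trans (zipWith-zeroʳ _ (xs ++ zs)) (sym (zipWith-zeroʳ _ xs))
zip-++ˡ (x ∷ xs) zs (y ∷ ys) (s≤s p) = cong ((x , y) ∷_) (zip-++ˡ xs zs ys p)

zip-take : ∀ k (xs : List A) (ys : List B) → zip xs (take k ys) ≡ take k (zip xs ys)
zip-take zero    xs       ys       = zipWith-zeroʳ _ xs
zip-take (suc k) []       ys       = refl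
zip-take (suc k) (x ∷ xs) []       = refl
zip-take (suc k) (x ∷ xs) (y ∷ ys) = cong ((x , y) ∷_) (zip-take k xs ys)

++-cancel-length : (xs xs′ ys ys′ : List A) → length xs ≡ length xs′ →
  xs ++ ys ≡ xs′ ++ ys′ → xs ≡ xs′ × ys ≡ ys′
++-cancel-length []       []         _  _   _    eq = refl , eq
++-cancel-length (x ∷ xs) (x′ ∷ xs′) ys ys′ same eq
  with ∷-injective eq
... | refl , eq′ with ++-cancel-length xs xs′ ys ys′ (suc-injective same) eq′
...   | refl , eq″ = refl , eq″

move-↭ : ∀ k (r₁ r₂ r₃ : List A) → (r₁ ++ drop k r₃) ++ r₂ ++ take k r₃ ↭ r₁ ++ r₂ ++ r₃
move-↭ k r₁ r₂ r₃ =
  ↭-trans (↭-reflexive (++-assoc r₁ (drop k r₃) (r₂ ++ take k r₃)))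
    (++⁺ˡ r₁ (↭-trans (++-comm (drop k r₃) (r₂ ++ take k r₃))
      (↭-reflexive (trans (++-assoc r₂ (take k r₃) (drop k r₃))
                          (cong (r₂ ++_) (take++drop≡id k r₃))))))

InRange : ℕ → ℕ → Set
InRange n v = 1 ≤ v × v ≤ n

entries-in-range : ∀ {n f ξ₁ ξ₂ ξ₃} T → IsFTableau n f ξ₁ ξ₂ ξ₃ T →
  All (InRange n) (row₁ T ++ row₂ T ++ row₃ T)
entries-in-range {n} T t = All-resp-↭ (↭-sym (IsFTableau.filling t)) range
  where
  range : All (InRange n) (map suc (upTo n))
  range = All.map⁺ (All.applyUpTo⁺₁ (λ i → i) n (λ i<n → s≤s z≤n , i<n))

moveTail : ℕ → Tableau3 → Tableau3
moveTail m (tab r₁ r₂ r₃) = tab (r₁ ++ drop (length r₃ ∸ m) r₃) r₂ (take (length r₃ ∸ m) r₃)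

moveTail-injective : ∀ m T T′ → length (row₁ T) ≡ length (row₁ T′) →
  moveTail m T ≡ moveTail m T′ → T ≡ T′
moveTail-injective m (tab r₁ r₂ r₃) (tab r₁′ r₂′ r₃′) same eq
  with ++-cancel-length r₁ r₁′ _ _ same (cong row₁ eq) | cong row₂ eq
... | refl , tails | refl =
  cong (tab r₁ r₂) (begin
    r₃                                            ≡⟨ take++drop≡id (length r₃ ∸ m) r₃ ⟨
    take (length r₃ ∸ m) r₃ ++ drop (length r₃ ∸ m) r₃
                                                  ≡⟨ cong₂ _++_ (cong row₃ eq) tails ⟩
    take (length r₃′ ∸ m) r₃′ ++ drop (length r₃′ ∸ m) r₃′
                                                  ≡⟨ take++drop≡id (length r₃′ ∸ m) r₃′ ⟩
    r₃′                                           ∎)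
  where open ≡-Reasoning

module Saturation (n : ℕ) (f : ℕ → ℕ) (H : IsHessenberg n f) where
  open IsHessenberg H

  -- An element of [n] above the l-th bounce point is mapped beyond the next
  -- one, by monotonicity of f: f z ≥ f (x_l + 1) = x_{l+1}.
  bounce-step : ∀ l z → bounceSeq f l < z → z ≤ n → bounceSeq f (suc l) ≤ f z
  bounce-step l z above z-bounded =
    monotone (bounceSeq f l + 1) z (m≤n+m 1 _)
      (subst (_≤ z) (+-comm 1 (bounceSeq f l)) above) z-bounded

  climb : ∀ l {z w} → bounceSeq f l < z → z ≤ n → z ≺[ f ] w → bounceSeq f (suc l) < w
  climb l {z} above z-bounded z≺w = ≤-<-trans (bounce-step l z above z-bounded) z≺w

  chain-top : ∀ {x y z} → InRange n x → InRange n y → InRange n z →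
    x ≺[ f ] y → y ≺[ f ] z → bounceSeq f 3 ≤ f z
  chain-top (1≤x , x≤n) (_ , y≤n) (_ , z-bounded) x≺y y≺z =
    bounce-step 2 _ (climb 1 (climb 0 1≤x x≤n x≺y) y≤n y≺z) z-bounded

  thirdRow-saturated : bounceSeq f 3 ≡ n → ∀ r₁ r₂ r₃ →
    All (InRange n) r₁ → All (InRange n) r₂ → All (InRange n) r₃ →
    ColumnsOK f r₁ r₂ → ColumnsOK f r₂ r₃ →
    length r₃ ≤ length r₂ → length r₂ ≤ length r₁ →
    All (λ z → n ≤ f z) r₃
  thirdRow-saturated x₃≡n r₁ r₂ [] _ _ _ _ _ _ _ = []
  thirdRow-saturated x₃≡n (x ∷ r₁) (y ∷ r₂) (z ∷ r₃) (gx ∷ g₁) (gy ∷ g₂) (gz ∷ g₃)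
      (x≺y ∷ c₁₂) (y≺z ∷ c₂₃) (s≤s l₃₂) (s≤s l₂₁) =
    subst (_≤ f z) x₃≡n (chain-top gx gy gz x≺y y≺z)
      ∷ thirdRow-saturated x₃≡n r₁ r₂ r₃ g₁ g₂ g₃ c₁₂ c₂₃ l₃₂ l₂₁

saturated-not-below : ∀ {n f a c} → a ≤ n → n ≤ f c → ¬ (c ≺[ f ] a)
saturated-not-below a≤n n≤fc c≺a = <⇒≱ c≺a (≤-trans a≤n n≤fc)

rowOK-append-saturated : ∀ {n} f r s → All (InRange n) r → All (λ c → n ≤ f c) s →
  RowOK f r → RowOK f s → RowOK f (r ++ s)
rowOK-append-saturated f r s inRange saturated rowR rowS =
  linked-++ rowR rowS
    (All.map (λ (_ , a≤n) → All.map (saturated-not-below {f = f} a≤n) saturated) inRange)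

moveTail-tableau : ∀ n f → IsHessenberg n f → bounceSeq f 3 ≡ n →
  ∀ ξ₁ ξ₂ ξ₃ m → ξ₂ ≤ ξ₁ → ξ₃ ≤ ξ₂ → m ≤ ξ₃ →
  ∀ T → IsFTableau n f ξ₁ ξ₂ ξ₃ T → IsFTableau n f (ξ₁ + m) ξ₂ (ξ₃ ∸ m) (moveTail m T)
moveTail-tableau n f H x₃≡n ξ₁ ξ₂ ξ₃ m ξ₂≤ξ₁ ξ₃≤ξ₂ m≤ξ₃ T@(tab r₁ r₂ r₃) t = record
  { shape₁  = trans (length-++ r₁) (cong₂ _+_ shape₁ moved-length)
  ; shape₂  = shape₂
  ; shape₃  = kept-length
  ; filling = ↭-trans (move-↭ k r₁ r₂ r₃) filling
  ; cols₁₂  = subst (All _) (sym (zip-++ˡ r₁ (drop k r₃) r₂ len₂≤len₁)) cols₁₂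
  ; cols₂₃  = subst (All _) (sym (zip-take k r₂ r₃)) (All.take⁺ k cols₂₃)
  ; rowOK₁  = rowOK-append-saturated f r₁ (drop k r₃) in₁ (All.drop⁺ k saturated)
                rowOK₁ (linked-drop k rowOK₃)
  ; rowOK₂  = rowOK₂
  ; rowOK₃  = linked-take k rowOK₃
  }
  where
  open IsFTableau t
  open ≡-Reasoning
  k = length r₃ ∸ m

  moved-length : length (drop k r₃) ≡ m
  moved-length = begin
    length (drop k r₃)        ≡⟨ length-drop k r₃ ⟩
    length r₃ ∸ k             ≡⟨ cong (λ ℓ → ℓ ∸ (ℓ ∸ m)) shape₃ ⟩
    ξ₃ ∸ (ξ₃ ∸ m)             ≡⟨ m∸[m∸n]≡n m≤ξ₃ ⟩
    m                         ∎

  kept-length : length (take k r₃) ≡ ξ₃ ∸ m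
  kept-length = begin
    length (take k r₃)        ≡⟨ length-take k r₃ ⟩
    k ⊓ length r₃             ≡⟨ cong (λ ℓ → (ℓ ∸ m) ⊓ ℓ) shape₃ ⟩
    (ξ₃ ∸ m) ⊓ ξ₃             ≡⟨ m≤n⇒m⊓n≡m (m∸n≤m ξ₃ m) ⟩
    ξ₃ ∸ m                    ∎

  len₂≤len₁ : length r₂ ≤ length r₁
  len₂≤len₁ = subst₂ _≤_ (sym shape₂) (sym shape₁) ξ₂≤ξ₁

  len₃≤len₂ : length r₃ ≤ length r₂
  len₃≤len₂ = subst₂ _≤_ (sym shape₃) (sym shape₂) ξ₃≤ξ₂

  in-all = entries-in-range T t
  in₁ = All.++⁻ˡ r₁ in-all
  in₂ = All.++⁻ˡ r₂ (All.++⁻ʳ r₁ in-all)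
  in₃ = All.++⁻ʳ r₂ (All.++⁻ʳ r₁ in-all)

  saturated : All (λ z → n ≤ f z) r₃
  saturated = Saturation.thirdRow-saturated n f H x₃≡n r₁ r₂ r₃ in₁ in₂ in₃
                cols₁₂ cols₂₃ len₃≤len₂ len₂≤len₁

lemma4p2 : (n : ℕ) (f : ℕ → ℕ) → IsHessenberg n f → BounceNumber n f 3 →
    (ξ₁ ξ₂ ξ₃ : ℕ) → ξ₂ ≤ ξ₁ → ξ₃ ≤ ξ₂ → ξ₁ + ξ₂ + ξ₃ ≡ n →
    (1 ≤ ξ₃ →
      (∀ T → IsFTableau n f ξ₁ ξ₂ ξ₃ T → IsFTableau n f (ξ₁ + 1) ξ₂ (ξ₃ ∸ 1) (σ□ T))
      × (∀ T T′ → IsFTableau n f ξ₁ ξ₂ ξ₃ T → IsFTableau n f ξ₁ ξ₂ ξ₃ T′ →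
           σ□ T ≡ σ□ T′ → T ≡ T′))
    × (2 ≤ ξ₃ →
      (∀ T → IsFTableau n f ξ₁ ξ₂ ξ₃ T → IsFTableau n f (ξ₁ + 2) ξ₂ (ξ₃ ∸ 2) (σ□□ T))
      × (∀ T T′ → IsFTableau n f ξ₁ ξ₂ ξ₃ T → IsFTableau n f ξ₁ ξ₂ ξ₃ T′ →
           σ□□ T ≡ σ□□ T′ → T ≡ T′))
lemma4p2 n f H (x₃≡n , _) ξ₁ ξ₂ ξ₃ ξ₂≤ξ₁ ξ₃≤ξ₂ _ = moveBy 1 , moveBy 2
  where
  moveBy : ∀ m → m ≤ ξ₃ →
    (∀ T → IsFTableau n f ξ₁ ξ₂ ξ₃ T → IsFTableau n f (ξ₁ + m) ξ₂ (ξ₃ ∸ m) (moveTail m T))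
    × (∀ T T′ → IsFTableau n f ξ₁ ξ₂ ξ₃ T → IsFTableau n f ξ₁ ξ₂ ξ₃ T′ →
         moveTail m T ≡ moveTail m T′ → T ≡ T′)
  moveBy m m≤ξ₃ =
    moveTail-tableau n f H x₃≡n ξ₁ ξ₂ ξ₃ m ξ₂≤ξ₁ ξ₃≤ξ₂ m≤ξ₃ ,
    λ T T′ t t′ → moveTail-injective m T T′
      (trans (IsFTableau.shape₁ t) (sym (IsFTableau.shape₁ t′)))
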